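{- Let $q=p^r$ with $p$ prime and $r$ a positive integer, and let $T(X)=X^{q^2}+X^q+X$. A point of $\mathbb{P}^2(\mathbb{F}_{q^3})$ lies on the curve $u^{q-1}+v^{q-1}+w^{q-1}=0$ if and only if it is of one of the following forms: (1) $(c v^{q+1} : v : 1)$ with $c\in\mathbb{F}_q^*$ and $v$ a nonzero root of $T(X)$; (2) $(c v^{ -q} : v : 1)$ with $c\in\mathbb{F}_q^*$ and $v$ a nonzero root of $T(1/X)$; (3) when $q$ is even: $(u:v:w)$ with $u,v,w\in\mathbb{F}_q$ and precisely one of $u,v,w$ equal to zero.
   Context: $\mathbb{F}_{q^3}$ is the finite field with $q^3$ elements and $\mathbb{P}^2(\mathbb{F}_{q^3})$ the projective plane over it; $\mathbb{F}_q^*$ is the multiplicative group of $\mathbb{F}_q$. Roots of $T(X)$ and of $T(1/X)$ are taken in an algebraic closure of $\mathbb{F}_q$. -}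

module Defs where

open import Level using (0ℓ)
open import Data.Nat using (ℕ; zero; suc; _∸_) renaming (_*_ to _*ℕ_)
open import Data.Fin using (Fin)
open import Data.Product using (Σ; ∃; _×_; _,_)
open import Data.Sum using (_⊎_)
open import Relation.Nullary using (¬_)
open import Relation.Binary.PropositionalEquality using (_≡_)
open import Algebra.Core using (Op₁; Op₂)
open import Algebra.Structures using (IsCommutativeRing)
open import Function.Bundles using (_↔_)

record FiniteField (n : ℕ) : Set₁ where
  infixl 6 _+_
  infixl 7 _*_
  field
    Carrier : Set
    _+_ _*_ : Op₂ Carrier
    -_ : Op₁ Carrier
    0# 1# : Carrier
    isCommutativeRing : IsCommutativeRing _≡_ _+_ _*_ -_ 0# 1#
    0≢1 : ¬ (0# ≡ 1#)
    inverse : ∀ x → ¬ (x ≡ 0#) → ∃ λ y → x * y ≡ 1#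
    card : Carrier ↔ Fin n

  _^_ : Carrier → ℕ → Carrier
  x ^ zero = 1#
  x ^ suc k = x * (x ^ k)

  NonZeroTriple : Carrier → Carrier → Carrier → Set
  NonZeroTriple u v w = ¬ (u ≡ 0# × v ≡ 0# × w ≡ 0#)

  SamePoint : Carrier → Carrier → Carrier → Carrier → Carrier → Carrier → Set
  SamePoint u v w a b c =
    ∃ λ λ' → ¬ (λ' ≡ 0#) × (u ≡ λ' * a) × (v ≡ λ' * b) × (w ≡ λ' * c)

  InFq : ℕ → Carrier → Set
  InFq q x = x ^ q ≡ x

  InFqStar : ℕ → Carrier → Set
  InFqStar q x = InFq q x × ¬ (x ≡ 0#)

  T : ℕ → Carrier → Carrier
  T q x = x ^ (q *ℕ q) + x ^ q + x

  OnCurve : ℕ → Carrier → Carrier → Carrier → Set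
  OnCurve q u v w = u ^ (q ∸ 1) + v ^ (q ∸ 1) + w ^ (q ∸ 1) ≡ 0#

  Form1 : ℕ → Carrier → Carrier → Carrier → Set
  Form1 q u v w = ∃ λ c → ∃ λ t →
    InFqStar q c × ¬ (t ≡ 0#) × T q t ≡ 0# ×
    SamePoint u v w (c * t ^ (q Data.Nat.+ 1)) t 1#

  -- form (2): (c t^{-q} : t : 1), c ∈ F_q^*, t nonzero with T(1/t) = 0;
  -- s denotes t⁻¹, so t^{-q} = s^q
  Form2 : ℕ → Carrier → Carrier → Carrier → Set
  Form2 q u v w = ∃ λ c → ∃ λ t → ∃ λ s →
    InFqStar q c × ¬ (t ≡ 0#) × t * s ≡ 1# × T q s ≡ 0# ×
    SamePoint u v w (c * s ^ q) t 1#

  ExactlyOneZero : Carrier → Carrier → Carrier → Set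
  ExactlyOneZero a b c =
    (a ≡ 0# × ¬ (b ≡ 0#) × ¬ (c ≡ 0#)) ⊎
    (¬ (a ≡ 0#) × b ≡ 0# × ¬ (c ≡ 0#)) ⊎
    (¬ (a ≡ 0#) × ¬ (b ≡ 0#) × c ≡ 0#)

  Form3 : ℕ → Carrier → Carrier → Carrier → Set
  Form3 q u v w = ∃ λ a → ∃ λ b → ∃ λ c →
    InFq q a × InFq q b × InFq q c × ExactlyOneZero a b c ×
    SamePoint u v w a b c

{-# OPTIONS --safe #-}
-- Write m = q ∸ 1, so that the curve is u^m + v^m + w^m = 0. On the chart w = 1 put a = U^m and
-- b = V^m; then a + b + 1 = 0, and since x^(q^3) = x both a and b have norm a·a^q·a^(q^2) = 1.
-- Applying Frobenius to a + b + 1 = 0 expresses a, a^q, a^(q^2) through b, and the norm of a then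
-- factors as (b·b^q + b + 1)(b·b^q + b^q + 1) = 0. As T(x) = x·(x^m·(x^m)^q + x^m + 1), the first
-- factor says T(V) = 0 and the second T(1/V) = 0; in either case U is V^(q+1), resp. V^(-q), times
-- some c with c^m = 1. If a coordinate vanishes, the ratio Z of the other two has Z^m = -1, and the
-- norm of Z^m being 1 forces -1 = 1, so q is even and Z lies in F_q.

module Submission where

open import Level using (0ℓ)
open import Data.Nat as ℕ using (ℕ; zero; suc; _<_; _≤_; _!; _∸_; z≤n; s≤s; NonZero)
import Data.Nat.Properties as ℕ
open import Data.Nat.Divisibility
  using (_∣_; divides; _∣0; ∣⇒≤; ∣1⇒≡1; ∣-refl; ∣m∣n⇒∣m+n; m∣m*n; ∣m⇒∣m*n)
open import Data.Nat.DivMod using (m/n*n≡m)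
open import Data.Nat.Tactic.RingSolver using (solve-∀)
open import Data.Nat.Primality
  using (Prime; euclidsLemma; prime[2]; prime⇒nonZero; prime⇒nonTrivial; prime⇒irreducible)
open import Data.Nat.Combinatorics using (_C_; nCk≡n!/k![n-k]!; k![n∸k]!∣n!; nCn≡1)
open import Data.Fin as Fin using (Fin)
import Data.Fin.Properties as Fin
open import Data.Vec.Functional using (Vector; tail; init; last)
open import Data.Sum using (_⊎_; inj₁; inj₂; [_,_]′)
import Data.Sum as Sum
open import Function using (id; _∘_)
open import Data.Product using (∃; _×_; _,_; proj₁; proj₂)
open import Relation.Nullary using (¬_; yes; no)
open import Relation.Nullary.Negation using (contradiction)
open import Relation.Binary.PropositionalEquality
  using (_≡_; _≢_; refl; sym; trans; cong; cong₂; subst; module ≡-Reasoning)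
open import Algebra.Bundles using (Monoid; CommutativeSemiring; CommutativeMonoid; CommutativeRing)
open import Function.Bundles using (_↔_; Inverse; mk↔ₛ′; _⇔_; mk⇔; Equivalence)
open import Function.Construct.Composition using (_↔-∘_)
open import Function.Construct.Symmetry using (↔-sym)
open import Function.Properties.Inverse using (↔⇒↣)
open import Relation.Binary.Definitions using (DecidableEquality)
open import Relation.Nullary.Decidable using (via-injection)
open import Defs

prime>1 : ∀ {p} → Prime p → 1 < p
prime>1 {p} pp = ℕ.nonTrivial⇒n>1 p {{prime⇒nonTrivial pp}}

prime∤! : ∀ {p m} → Prime p → m < p → ¬ (p ∣ m !)
prime∤! {m = zero} pp _ p∣1 = ℕ.<-irrefl (sym (∣1⇒≡1 p∣1)) (prime>1 pp)
prime∤! {m = suc m} pp m<p p∣m! with euclidsLemma (suc m) (m !) pp p∣m!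
... | inj₁ p∣1+m = ℕ.<⇒≱ m<p (∣⇒≤ p∣1+m)
... | inj₂ p∣m!′ = prime∤! pp (ℕ.<-trans (ℕ.n<1+n m) m<p) p∣m!′

n∣n! : ∀ n → .{{NonZero n}} → n ∣ n !
n∣n! (suc n) = m∣m*n (n !)

nCk*k!*[n∸k]!≡n! : ∀ {n k} → k ≤ n → (n C k) ℕ.* (k ! ℕ.* (n ∸ k) !) ≡ n !
nCk*k!*[n∸k]!≡n! {n} {k} k≤n = trans (cong (ℕ._* D) (nCk≡n!/k![n-k]! k≤n)) (m/n*n≡m (k![n∸k]!∣n! k≤n))
  where
  D = k ! ℕ.* (n ∸ k) !
  instance _ = ℕ.m*n≢0 (k !) ((n ∸ k) !) {{k ℕ.!≢0}} {{(n ∸ k) ℕ.!≢0}}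

prime∣pCk : ∀ {p k} → Prime p → 0 < k → k < p → p ∣ p C k
prime∣pCk {p} {k} pp 0<k k<p = [ id , (λ p∣D → contradiction p∣D p∤D) ]′ (euclidsLemma (p C k) D pp p∣pCk*D)
  where
  D = k ! ℕ.* (p ∸ k) !
  p∣pCk*D : p ∣ (p C k) ℕ.* D
  p∣pCk*D = subst (p ∣_) (sym (nCk*k!*[n∸k]!≡n! (ℕ.<⇒≤ k<p))) (n∣n! p {{prime⇒nonZero pp}})
  p∤D : ¬ (p ∣ D)
  p∤D p∣D = [ prime∤! pp k<p , prime∤! pp (ℕ.∸-monoʳ-< 0<k (ℕ.<⇒≤ k<p)) ]′ (euclidsLemma (k !) ((p ∸ k) !) pp p∣D)

[q+1]*m≡m+m*q : ∀ m → (suc m ℕ.+ 1) ℕ.* m ≡ m ℕ.+ m ℕ.* suc m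
[q+1]*m≡m+m*q = solve-∀

q*q≡1+m+m*q : ∀ m → suc m ℕ.* suc m ≡ suc (m ℕ.+ m ℕ.* suc m)
q*q≡1+m+m*q = solve-∀

q^3≡1+m+m*q+m*q*q : ∀ m → suc (m ℕ.+ (m ℕ.* suc m ℕ.+ m ℕ.* suc m ℕ.* suc m)) ≡ suc m ℕ.^ 3
q^3≡1+m+m*q+m*q*q = expanded
  where
  expanded : ∀ m → suc (m ℕ.+ (m ℕ.* suc m ℕ.+ m ℕ.* suc m ℕ.* suc m)) ≡ suc m ℕ.* (suc m ℕ.* (suc m ℕ.* 1))
  expanded = solve-∀

2≤p^[1+r] : ∀ {p} → Prime p → ∀ r → 2 ≤ p ℕ.^ suc r
2≤p^[1+r] {p} pp r = ℕ.≤-trans (prime>1 pp) (ℕ.m≤m*n p (p ℕ.^ r) {{ℕ.m^n≢0 p r {{prime⇒nonZero pp}}}})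

prime∣^⇒∣ : ∀ {d} m n → Prime d → d ∣ m ℕ.^ n → d ∣ m
prime∣^⇒∣ m zero pd d∣1 = contradiction (∣1⇒≡1 d∣1) (ℕ.>⇒≢ (prime>1 pd))
prime∣^⇒∣ m (suc n) pd d∣m^n with euclidsLemma m (m ℕ.^ n) pd d∣m^n
... | inj₁ d∣m = d∣m
... | inj₂ d∣m^n′ = prime∣^⇒∣ m n pd d∣m^n′

module Frobenius {a ℓ} (R : CommutativeSemiring a ℓ) where
  open CommutativeSemiring R renaming (refl to ≈-refl; sym to ≈-sym; trans to ≈-trans)
  open import Algebra.Properties.Semiring.Mult semiring using (×-congʳ; ×-assoc-*; ×-assocˡ; ×-homo-1)
    renaming (_×_ to _·_)
  open import Algebra.Properties.Semiring.Exp semiring using (_^_; ^-assocʳ; ^-congˡ)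
  open import Algebra.Properties.CommutativeSemiring.Binomial R using (theorem; binomialTerm)
  open import Algebra.Properties.CommutativeMonoid.Sum +-commutativeMonoid
    using (sum; sum-init-last; sum-cong-≋; sum-replicate-zero)
  open import Relation.Binary.Reasoning.Setoid setoid

  [d*p]·z≈0 : ∀ {p} → p · 1# ≈ 0# → ∀ d z → (d ℕ.* p) · z ≈ 0#
  [d*p]·z≈0 {p} p≈0 d z = begin
    (d ℕ.* p) · z      ≡⟨ cong (_· z) (ℕ.*-comm d p) ⟩
    (p ℕ.* d) · z      ≈⟨ ×-assocˡ z p d ⟨
    p · (d · z)        ≈⟨ ×-congʳ p (*-identityˡ _) ⟨
    p · (1# * d · z)   ≈⟨ ×-assoc-* p 1# (d · z) ⟨
    (p · 1#) * d · z   ≈⟨ *-congʳ p≈0 ⟩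
    0# * d · z         ≈⟨ zeroˡ _ ⟩
    0#                 ∎

  frobenius : ∀ {p} → Prime p → p · 1# ≈ 0# → ∀ x y → (x + y) ^ p ≈ x ^ p + y ^ p
  frobenius {zero} pp = contradiction (prime>1 pp) λ ()
  frobenius {suc zero} pp = contradiction (prime>1 pp) (ℕ.<-irrefl refl)
  frobenius {p@(suc (suc p₂))} pp p≈0 x y = begin
    (x + y) ^ p                                           ≈⟨ theorem p x y ⟩
    term Fin.zero + sum (tail term)                       ≈⟨ +-congˡ (sum-init-last (tail term)) ⟩
    term Fin.zero + (sum (init (tail term)) + last (tail term))
                                                          ≈⟨ +-cong first≈y^p (+-cong middle≈0 last≈x^p) ⟩
    y ^ p + (0# + x ^ p)                                  ≈⟨ +-congˡ (+-identityˡ _) ⟩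
    y ^ p + x ^ p                                         ≈⟨ +-comm _ _ ⟩
    x ^ p + y ^ p                                         ∎
    where
    term = binomialTerm x y p
    first≈y^p : term Fin.zero ≈ y ^ p
    first≈y^p = ≈-trans (×-homo-1 _) (*-identityˡ _)
    -- term i reduces to τ (toℕ i).
    τ : ℕ → Carrier
    τ j = (p C j) · (x ^ j * y ^ (p ∸ j))
    τ-vanish : ∀ {j} → 0 < j → j < p → τ j ≈ 0#
    τ-vanish {j} 0<j j<p with divides d pCj≡d*p ← prime∣pCk pp 0<j j<p =
      ≈-trans (reflexive (cong (_· (x ^ j * y ^ (p ∸ j))) pCj≡d*p)) ([d*p]·z≈0 p≈0 d _)
    middle≈0 : sum (init (tail term)) ≈ 0#
    middle≈0 = ≈-trans (sum-cong-≋ vanish) (sum-replicate-zero (suc p₂))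
      where
      vanish : ∀ i → init (tail term) i ≈ 0#
      vanish i = τ-vanish (s≤s z≤n) (s≤s (subst (_< suc p₂) (sym (Fin.toℕ-inject₁ i)) (Fin.toℕ<n i)))
    last≈x^p : last (tail term) ≈ x ^ p
    last≈x^p = begin
      last (tail term)                 ≡⟨ cong (λ k → (p C k) · (x ^ k * y ^ (p ∸ k))) (cong suc (Fin.toℕ-fromℕ (suc p₂))) ⟩
      (p C p) · (x ^ p * y ^ (p ∸ p))  ≡⟨ cong₂ (λ c e → c · (x ^ p * y ^ e)) (nCn≡1 p) (ℕ.n∸n≡0 p) ⟩
      1 · (x ^ p * 1#)                 ≈⟨ ×-homo-1 _ ⟩
      x ^ p * 1#                       ≈⟨ *-identityʳ _ ⟩
      x ^ p                            ∎

  frobenius-^ : ∀ {p} → Prime p → p · 1# ≈ 0# → ∀ r x y → (x + y) ^ (p ℕ.^ r) ≈ x ^ (p ℕ.^ r) + y ^ (p ℕ.^ r)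
  frobenius-^ pp p≈0 zero x y = distribʳ 1# x y
  frobenius-^ {p} pp p≈0 (suc r) x y = begin
    (x + y) ^ (p ℕ.* p ℕ.^ r)          ≈⟨ ^-assocʳ (x + y) p (p ℕ.^ r) ⟨
    ((x + y) ^ p) ^ p ℕ.^ r            ≈⟨ ^-congˡ (p ℕ.^ r) (frobenius pp p≈0 x y) ⟩
    (x ^ p + y ^ p) ^ p ℕ.^ r          ≈⟨ frobenius-^ pp p≈0 r (x ^ p) (y ^ p) ⟩
    (x ^ p) ^ p ℕ.^ r + (y ^ p) ^ p ℕ.^ r  ≈⟨ +-cong (^-assocʳ x p (p ℕ.^ r)) (^-assocʳ y p (p ℕ.^ r)) ⟩
    x ^ (p ℕ.* p ℕ.^ r) + y ^ (p ℕ.* p ℕ.^ r) ∎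

module _ {a ℓ} (M : Monoid a ℓ) where
  open Monoid M renaming (trans to ≈-trans)
  open import Algebra.Properties.Monoid.Sum M using (sum; sum-cong-≋; sum-replicate-zero)

  sum-single : ∀ {k} (t : Vector Carrier k) j → (∀ i → i ≢ j → t i ≈ ε) → sum t ≈ t j
  sum-single {suc k} t Fin.zero t≈ε = ≈-trans (∙-congˡ (≈-trans (sum-cong-≋ λ i → t≈ε (Fin.suc i) λ ()) (sum-replicate-zero k))) (identityʳ _)
  sum-single t (Fin.suc j) t≈ε =
    ≈-trans (∙-cong (t≈ε Fin.zero λ ()) (sum-single (tail t) j λ i i≢j → t≈ε (Fin.suc i) (i≢j ∘ Fin.suc-injective))) (identityˡ _)

module FiniteFieldProperties {n : ℕ} (F : FiniteField n) where
  open FiniteField F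
  open ≡-Reasoning

  commutativeRing : CommutativeRing 0ℓ 0ℓ
  commutativeRing = record { isCommutativeRing = isCommutativeRing }

  open CommutativeRing commutativeRing public
    using ( +-assoc; +-identityˡ; +-identityʳ; -‿inverseˡ; -‿inverseʳ
          ; *-assoc; *-comm; *-identityˡ; *-identityʳ; distribˡ; zeroˡ; zeroʳ
          ; commutativeSemiring; +-commutativeMonoid; *-commutativeMonoid)
  open CommutativeRing commutativeRing using (ring; semiring; +-group)
  open import Algebra.Properties.Ring ring public using (-‿distribˡ-*; -‿distribʳ-*; -‿involutive)
  open import Algebra.Properties.Group +-group using (inverseˡ-unique; loop)
  open import Algebra.Properties.Loop loop using (identityˡ-unique; identityʳ-unique)
  open import Algebra.Properties.Semiring.Mult semiring public using (×1-homo-*) renaming (_×_ to _·_)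
  import Algebra.Properties.Semiring.Exp semiring as Exp
  open import Algebra.Solver.Ring.NaturalCoefficients.Default commutativeSemiring public
    using (solve; _:+_; _:*_; con; _:=_)

  infix 4 _≟_
  _≟_ : DecidableEquality Carrier
  _≟_ = via-injection (↔⇒↣ card) Fin._≟_

  1≢0 : 1# ≢ 0#
  1≢0 = 0≢1 ∘ sym

  x+y≡0⇒x≡-y : ∀ {x y} → x + y ≡ 0# → x ≡ - y
  x+y≡0⇒x≡-y {x} {y} = inverseˡ-unique x y

  -x≡1⇒x+1≡0 : ∀ {x} → - x ≡ 1# → x + 1# ≡ 0#
  -x≡1⇒x+1≡0 {x} -x≡1 = trans (cong (x +_) (sym -x≡1)) (-‿inverseʳ x)

  inv : ∀ x → x ≢ 0# → Carrier
  inv x x≢0 = proj₁ (inverse x x≢0)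

  inv-inverseʳ : ∀ {x} (x≢0 : x ≢ 0#) → x * inv x x≢0 ≡ 1#
  inv-inverseʳ {x} x≢0 = proj₂ (inverse x x≢0)

  inv-inverseˡ : ∀ {x} (x≢0 : x ≢ 0#) → inv x x≢0 * x ≡ 1#
  inv-inverseˡ x≢0 = trans (*-comm _ _) (inv-inverseʳ x≢0)

  x*[x⁻¹*y]≡y : ∀ {x} (x≢0 : x ≢ 0#) y → x * (inv x x≢0 * y) ≡ y
  x*[x⁻¹*y]≡y x≢0 y = trans (sym (*-assoc _ _ y)) (trans (cong (_* y) (inv-inverseʳ x≢0)) (*-identityˡ y))

  x⁻¹*[x*y]≡y : ∀ {x} (x≢0 : x ≢ 0#) y → inv x x≢0 * (x * y) ≡ y
  x⁻¹*[x*y]≡y x≢0 y = trans (sym (*-assoc _ _ y)) (trans (cong (_* y) (inv-inverseˡ x≢0)) (*-identityˡ y))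

  *-cancelˡ : ∀ {x y z} → x ≢ 0# → x * y ≡ x * z → y ≡ z
  *-cancelˡ {x} {y} {z} x≢0 xy≡xz =
    trans (sym (x⁻¹*[x*y]≡y x≢0 y)) (trans (cong (inv x x≢0 *_) xy≡xz) (x⁻¹*[x*y]≡y x≢0 z))

  x*y≡0⇒x≡0⊎y≡0 : ∀ {x y} → x * y ≡ 0# → x ≡ 0# ⊎ y ≡ 0#
  x*y≡0⇒x≡0⊎y≡0 {x} {y} xy≡0 with x ≟ 0#
  ... | yes x≡0 = inj₁ x≡0
  ... | no x≢0 = inj₂ (*-cancelˡ x≢0 (trans xy≡0 (sym (zeroʳ x))))

  *-≢0 : ∀ {x y} → x ≢ 0# → y ≢ 0# → x * y ≢ 0#
  *-≢0 x≢0 y≢0 = [ x≢0 , y≢0 ]′ ∘ x*y≡0⇒x≡0⊎y≡0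

  inv-≢0 : ∀ {x} (x≢0 : x ≢ 0#) → inv x x≢0 ≢ 0#
  inv-≢0 {x} x≢0 x⁻¹≡0 = 1≢0 (trans (sym (inv-inverseʳ x≢0)) (trans (cong (x *_) x⁻¹≡0) (zeroʳ x)))

  -x*-y≡x*y : ∀ x y → - x * - y ≡ x * y
  -x*-y≡x*y x y = trans (sym (-‿distribˡ-* x (- y))) (trans (cong -_ (sym (-‿distribʳ-* x y))) (-‿involutive (x * y)))

  -- The power of FiniteField and that of the library agree only propositionally.
  ^≗Exp^ : ∀ x k → x ^ k ≡ x Exp.^ k
  ^≗Exp^ x zero = refl
  ^≗Exp^ x (suc k) = cong (x *_) (^≗Exp^ x k)

  ^-+ : ∀ x i j → x ^ (i ℕ.+ j) ≡ x ^ i * x ^ j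
  ^-+ x i j rewrite ^≗Exp^ x (i ℕ.+ j) | ^≗Exp^ x i | ^≗Exp^ x j = Exp.^-homo-* x i j

  ^-* : ∀ x i j → x ^ (i ℕ.* j) ≡ (x ^ i) ^ j
  ^-* x i j rewrite ^≗Exp^ x (i ℕ.* j) | ^≗Exp^ (x ^ i) j | ^≗Exp^ x i = sym (Exp.^-assocʳ x i j)

  *-^ : ∀ x y k → (x * y) ^ k ≡ x ^ k * y ^ k
  *-^ x y k rewrite ^≗Exp^ (x * y) k | ^≗Exp^ x k | ^≗Exp^ y k = ^-distrib-* x y k
    where open import Algebra.Properties.CommutativeSemiring.Exp commutativeSemiring using (^-distrib-*)

  1^ : ∀ k → 1# ^ k ≡ 1#
  1^ zero = refl
  1^ (suc k) = trans (*-identityˡ _) (1^ k)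

  ^-≢0 : ∀ {x} k → x ≢ 0# → x ^ k ≢ 0#
  ^-≢0 zero x≢0 = 1≢0
  ^-≢0 (suc k) x≢0 = *-≢0 x≢0 (^-≢0 k x≢0)

  x^k≡0⇒x≡0 : ∀ {x} k → x ^ suc k ≡ 0# → x ≡ 0#
  x^k≡0⇒x≡0 {x} k x^k≡0 with x ≟ 0#
  ... | yes x≡0 = x≡0
  ... | no x≢0 = contradiction x^k≡0 (^-≢0 (suc k) x≢0)

  x+y+1≡0⇒x≡-[y+1] : ∀ {x y} → x + y + 1# ≡ 0# → x ≡ - (y + 1#)
  x+y+1≡0⇒x≡-[y+1] e = x+y≡0⇒x≡-y (trans (sym (+-assoc _ _ _)) e)

  SamePoint-≡ : ∀ {u v w a b c} → u ≡ a → v ≡ b → w ≡ c → SamePoint u v w a b c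
  SamePoint-≡ refl refl refl = 1# , 1≢0 , sym (*-identityˡ _) , sym (*-identityˡ _) , sym (*-identityˡ _)

  SamePoint-sym : ∀ {u v w a b c} → SamePoint u v w a b c → SamePoint a b c u v w
  SamePoint-sym (l , l≢0 , refl , refl , refl) =
    inv l l≢0 , inv-≢0 l≢0 , sym (x⁻¹*[x*y]≡y l≢0 _) , sym (x⁻¹*[x*y]≡y l≢0 _) , sym (x⁻¹*[x*y]≡y l≢0 _)

  SamePoint-trans : ∀ {u v w a b c a′ b′ c′} →
                    SamePoint u v w a b c → SamePoint a b c a′ b′ c′ → SamePoint u v w a′ b′ c′
  SamePoint-trans (l , l≢0 , refl , refl , refl) (l′ , l′≢0 , refl , refl , refl) =
    l * l′ , *-≢0 l≢0 l′≢0 , sym (*-assoc l l′ _) , sym (*-assoc l l′ _) , sym (*-assoc l l′ _)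

  Form1-invariant : ∀ {q u v w a b c} → SamePoint u v w a b c → Form1 q a b c → Form1 q u v w
  Form1-invariant sp (c , t , c∈Fq* , t≢0 , Tt≡0 , sp′) = c , t , c∈Fq* , t≢0 , Tt≡0 , SamePoint-trans sp sp′

  Form2-invariant : ∀ {q u v w a b c} → SamePoint u v w a b c → Form2 q a b c → Form2 q u v w
  Form2-invariant sp (c , t , s , c∈Fq* , t≢0 , ts≡1 , Ts≡0 , sp′) =
    c , t , s , c∈Fq* , t≢0 , ts≡1 , Ts≡0 , SamePoint-trans sp sp′

  module FieldIndexedSum (M : CommutativeMonoid 0ℓ 0ℓ) where
    open CommutativeMonoid M using (_≈_; _∙_; ε; reflexive; monoid) renaming (Carrier to A; trans to ≈-trans)
    open import Algebra.Properties.CommutativeMonoid.Sum M public using (sum)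
    open import Algebra.Properties.CommutativeMonoid.Sum M using (∑-permute; sum-cong-≗; ∑-distrib-+)

    ∑ : (Carrier → A) → A
    ∑ f = sum (f ∘ Inverse.from card)

    ∑-cong : ∀ {f g : Carrier → A} → (∀ x → f x ≡ g x) → ∑ f ≡ ∑ g
    ∑-cong f≗g = sum-cong-≗ (f≗g ∘ Inverse.from card)

    ∑-distrib : ∀ (f g : Carrier → A) → ∑ (λ x → f x ∙ g x) ≈ ∑ f ∙ ∑ g
    ∑-distrib f g = ∑-distrib-+ (f ∘ Inverse.from card) (g ∘ Inverse.from card)

    ∑-reindex : (σ : Carrier ↔ Carrier) (f : Carrier → A) → ∑ f ≈ ∑ (f ∘ Inverse.to σ)
    ∑-reindex σ f = ≈-trans (∑-permute (f ∘ Inverse.from card) (card ↔-∘ (σ ↔-∘ ↔-sym card)))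
      (reflexive (sum-cong-≗ (cong f ∘ Inverse.strictlyInverseʳ card ∘ Inverse.to σ ∘ Inverse.from card)))

    ∑-single : ∀ x₀ (f : Carrier → A) → (∀ x → x ≢ x₀ → f x ≈ ε) → ∑ f ≈ f x₀
    ∑-single x₀ f f≈ε = ≈-trans
      (sum-single monoid (f ∘ Inverse.from card) (Inverse.to card x₀)
        (λ i i≢ → f≈ε _ (i≢ ∘ trans (sym (Inverse.strictlyInverseˡ card i)) ∘ cong (Inverse.to card))))
      (reflexive (cong f (Inverse.strictlyInverseʳ card x₀)))

  open FieldIndexedSum +-commutativeMonoid using (∑; ∑-reindex; ∑-distrib)
  open FieldIndexedSum *-commutativeMonoid using ()
    renaming (∑ to ∏; ∑-reindex to ∏-reindex; ∑-distrib to ∏-distrib; ∑-single to ∏-single; ∑-cong to ∏-cong; sum to product)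
  open import Algebra.Properties.Monoid.Sum (CommutativeRing.+-monoid commutativeRing) using (sum-replicate)

  characteristic : n · 1# ≡ 0#
  characteristic = identityʳ-unique (∑ id) (n · 1#) (begin
    ∑ id + n · 1#           ≡⟨ cong (∑ id +_) (sym (sum-replicate n)) ⟩
    ∑ id + ∑ (λ _ → 1#)     ≡⟨ sym (∑-distrib id (λ _ → 1#)) ⟩
    ∑ (_+ 1#)               ≡⟨ sym (∑-reindex shift id) ⟩
    ∑ id                    ∎)
    where
    shift : Carrier ↔ Carrier
    shift = mk↔ₛ′ (_+ 1#) (_+ - 1#)
      (λ y → trans (+-assoc y _ _) (trans (cong (y +_) (-‿inverseˡ 1#)) (+-identityʳ y)))
      (λ y → trans (+-assoc y _ _) (trans (cong (y +_) (-‿inverseʳ 1#)) (+-identityʳ y)))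

  zeroToOne : Carrier → Carrier
  zeroToOne x with x ≟ 0#
  ... | yes _ = 1#
  ... | no _ = x

  oneExceptAtZero : Carrier → Carrier → Carrier
  oneExceptAtZero a x with x ≟ 0#
  ... | yes _ = a
  ... | no _ = 1#

  zeroToOne-≢0 : ∀ x → zeroToOne x ≢ 0#
  zeroToOne-≢0 x with x ≟ 0#
  ... | yes _ = 1≢0
  ... | no x≢0 = x≢0

  zeroToOne-* : ∀ {a} → a ≢ 0# → ∀ x → zeroToOne (a * x) * oneExceptAtZero a x ≡ a * zeroToOne x
  zeroToOne-* {a} a≢0 x with x ≟ 0# | a * x ≟ 0#
  ... | yes _    | yes _     = trans (*-identityˡ a) (sym (*-identityʳ a))
  ... | yes x≡0  | no ax≢0   = contradiction (trans (cong (a *_) x≡0) (zeroʳ a)) ax≢0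
  ... | no x≢0   | yes ax≡0  = contradiction ax≡0 (*-≢0 a≢0 x≢0)
  ... | no _     | no _      = *-identityʳ _

  ∏-oneExceptAtZero : ∀ a → ∏ (oneExceptAtZero a) ≡ a
  ∏-oneExceptAtZero a = trans (∏-single 0# (oneExceptAtZero a) away) atZero
    where
    away : ∀ x → x ≢ 0# → oneExceptAtZero a x ≡ 1#
    away x x≢0 with x ≟ 0#
    ... | yes x≡0 = contradiction x≡0 x≢0
    ... | no _ = refl
    atZero : oneExceptAtZero a 0# ≡ a
    atZero with 0# ≟ 0#
    ... | yes _ = refl
    ... | no 0≢0 = contradiction refl 0≢0

  product-≢0 : ∀ {k} (t : Vector Carrier k) → (∀ i → t i ≢ 0#) → product t ≢ 0#
  product-≢0 {zero} t _ = 1≢0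
  product-≢0 {suc k} t t≢0 = *-≢0 (t≢0 Fin.zero) (product-≢0 (tail t) (t≢0 ∘ Fin.suc))

  product-const : ∀ k a → product {k} (λ _ → a) ≡ a ^ k
  product-const zero a = refl
  product-const (suc k) a = cong (a *_) (product-const k a)

  0^n≡0 : 0# ^ n ≡ 0#
  0^n≡0 = go (Inverse.to card 0#)
    where
    go : ∀ {k} → Fin k → 0# ^ k ≡ 0#
    go {suc k} _ = zeroˡ _

  -- Reindexing the product P of the nonzero elements along y ↦ x * y gives P * x ≡ x ^ n * P;
  -- zeroToOne and oneExceptAtZero let both products range over the whole field.
  fermat : ∀ x → x ^ n ≡ x
  fermat x with x ≟ 0#
  ... | yes refl = 0^n≡0
  ... | no x≢0 = sym (*-cancelˡ P≢0 (begin
    P * x                                                    ≡⟨ cong (P *_) (∏-oneExceptAtZero x) ⟨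
    P * ∏ (oneExceptAtZero x)                                ≡⟨ cong (_* ∏ (oneExceptAtZero x)) (∏-reindex scale zeroToOne) ⟩
    ∏ (zeroToOne ∘ (x *_)) * ∏ (oneExceptAtZero x)           ≡⟨ ∏-distrib (zeroToOne ∘ (x *_)) (oneExceptAtZero x) ⟨
    ∏ (λ y → zeroToOne (x * y) * oneExceptAtZero x y)        ≡⟨ ∏-cong (zeroToOne-* x≢0) ⟩
    ∏ (λ y → x * zeroToOne y)                                ≡⟨ ∏-distrib (λ _ → x) zeroToOne ⟩
    ∏ (λ _ → x) * P                                          ≡⟨ cong (_* P) (product-const n x) ⟩
    x ^ n * P                                                ≡⟨ *-comm _ P ⟩
    P * x ^ n                                                ∎))
    where
    P = ∏ zeroToOne
    P≢0 : P ≢ 0#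
    P≢0 = product-≢0 _ (zeroToOne-≢0 ∘ Inverse.from card)
    scale : Carrier ↔ Carrier
    scale = mk↔ₛ′ (x *_) (inv x x≢0 *_) (x*[x⁻¹*y]≡y x≢0) (x⁻¹*[x*y]≡y x≢0)

  frobenius : ∀ {p} → Prime p → p · 1# ≡ 0# → ∀ r x y → (x + y) ^ (p ℕ.^ r) ≡ x ^ (p ℕ.^ r) + y ^ (p ℕ.^ r)
  frobenius {p} pp p≡0 r x y
    rewrite ^≗Exp^ (x + y) (p ℕ.^ r) | ^≗Exp^ x (p ℕ.^ r) | ^≗Exp^ y (p ℕ.^ r) =
    Frobenius.frobenius-^ commutativeSemiring pp p≡0 r x y

  ^·1 : ∀ m k → (m ℕ.^ k) · 1# ≡ (m · 1#) ^ k
  ^·1 m zero = +-identityʳ 1#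
  ^·1 m (suc k) = trans (×1-homo-* m (m ℕ.^ k)) (cong ((m · 1#) *_) (^·1 m k))

  ^·1≡0⇒·1≡0 : ∀ m k → (m ℕ.^ suc k) · 1# ≡ 0# → m · 1# ≡ 0#
  ^·1≡0⇒·1≡0 m k e = x^k≡0⇒x≡0 k (trans (sym (^·1 m (suc k))) e)

  1+1≡0⇒2∣ : 1# + 1# ≡ 0# → ∀ j → j · 1# ≡ 0# → 2 ∣ j
  1+1≡0⇒2∣ _ zero _ = 2 ∣0
  1+1≡0⇒2∣ _ (suc zero) 1+0≡0 = contradiction (trans (sym (+-identityʳ 1#)) 1+0≡0) 1≢0
  1+1≡0⇒2∣ 1+1≡0 (suc (suc j)) [2+j]·1≡0 = ∣m∣n⇒∣m+n (∣-refl {2}) (1+1≡0⇒2∣ 1+1≡0 j (begin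
    j · 1#                  ≡⟨ +-identityˡ _ ⟨
    0# + j · 1#             ≡⟨ cong (_+ j · 1#) 1+1≡0 ⟨
    1# + 1# + j · 1#        ≡⟨ +-assoc 1# 1# _ ⟩
    (2 ℕ.+ j) · 1#          ≡⟨ [2+j]·1≡0 ⟩
    0#                      ∎))

  prime-char-2∣⇔1+1≡0 : ∀ {p} → Prime p → p · 1# ≡ 0# → 2 ∣ p ⇔ 1# + 1# ≡ 0#
  prime-char-2∣⇔1+1≡0 {p} pp p·1≡0 = mk⇔ to (λ 1+1≡0 → 1+1≡0⇒2∣ 1+1≡0 p p·1≡0)
    where
    to : 2 ∣ p → 1# + 1# ≡ 0#
    to 2∣p with prime⇒irreducible pp 2∣p
    ... | inj₂ refl = trans (cong (1# +_) (sym (+-identityʳ 1#))) p·1≡0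

  norm-relation : ∀ {x y z} → x * (y * z) ≡ 1# → - (x + 1#) * (- (y + 1#) * - (z + 1#)) ≡ 1# →
                  (x * y + x + 1#) * (x * y + y + 1#) ≡ 0#
  norm-relation {x} {y} {z} xyz≡1 N≡1 = identityˡ-unique Q W (begin
    Q + W                                  ≡⟨ cong (Q +_) (*-identityʳ W) ⟨
    Q + W * 1#                             ≡⟨ cong (λ t → Q + W * t) xyz≡1 ⟨
    Q + W * (x * (y * z))                  ≡⟨ identity ⟩
    x * y * (R + 1#) + W                   ≡⟨ cong (λ t → x * y * t + W) R+1≡0 ⟩
    x * y * 0# + W                         ≡⟨ cong (_+ W) (zeroʳ (x * y)) ⟩
    0# + W                                 ≡⟨ +-identityˡ W ⟩
    W                                      ∎)
    where
    Q = (x * y + x + 1#) * (x * y + y + 1#)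
    W = x * y + x + y + 1#
    R = (x + 1#) * ((y + 1#) * (z + 1#))
    R+1≡0 : R + 1# ≡ 0#
    R+1≡0 = -x≡1⇒x+1≡0 (begin
      - R                                        ≡⟨ -‿distribˡ-* (x + 1#) _ ⟩
      - (x + 1#) * ((y + 1#) * (z + 1#))         ≡⟨ cong (- (x + 1#) *_) (-x*-y≡x*y (y + 1#) (z + 1#)) ⟨
      - (x + 1#) * (- (y + 1#) * - (z + 1#))     ≡⟨ N≡1 ⟩
      1#                                         ∎)
    identity : Q + W * (x * (y * z)) ≡ x * y * (R + 1#) + W
    identity = solve 3 (λ x y z →
      (x :* y :+ x :+ con 1) :* (x :* y :+ y :+ con 1) :+ (x :* y :+ x :+ y :+ con 1) :* (x :* (y :* z))
      := x :* y :* ((x :+ con 1) :* ((y :+ con 1) :* (z :+ con 1)) :+ con 1) :+ (x :* y :+ x :+ y :+ con 1)) refl x y z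

module Curve {N : ℕ} (F : FiniteField N) where
  open FiniteField F
  open FiniteFieldProperties F hiding (frobenius; fermat)
  open ≡-Reasoning

  Forms : ℕ → Carrier → Carrier → Carrier → Set
  Forms q u v w = Form1 q u v w ⊎ Form2 q u v w ⊎ (2 ∣ q × Form3 q u v w)

  Classification : ℕ → Set
  Classification q = ∀ u v w → NonZeroTriple u v w → OnCurve q u v w ⇔ Forms q u v w

  module _ (k : ℕ)
    (frobenius : ∀ x y → (x + y) ^ suc (suc k) ≡ x ^ suc (suc k) + y ^ suc (suc k))
    (fermat : ∀ x → x ^ (suc (suc k) ℕ.^ 3) ≡ x)
    (char2 : 2 ∣ suc (suc k) ⇔ 1# + 1# ≡ 0#)
    where

    q : ℕ
    q = suc (suc k)

    -- q ∸ 1, the exponent in OnCurve, reduces to m because q ≥ 2.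
    m : ℕ
    m = suc k

    0^m≡0 : 0# ^ m ≡ 0#
    0^m≡0 = zeroˡ _

    inFq⇒^m≡1 : ∀ {z} → z ≢ 0# → InFq q z → z ^ m ≡ 1#
    inFq⇒^m≡1 {z} z≢0 z^q≡z = *-cancelˡ z≢0 (trans z^q≡z (sym (*-identityʳ z)))

    ^m≡1⇒inFq : ∀ {z} → z ^ m ≡ 1# → InFq q z
    ^m≡1⇒inFq {z} z^m≡1 = trans (cong (z *_) z^m≡1) (*-identityʳ z)

    InFqStar-*-^m : ∀ {c} → InFqStar q c → ∀ x → (c * x) ^ m ≡ x ^ m
    InFqStar-*-^m {c} (c^q≡c , c≢0) x =
      trans (*-^ c x m) (trans (cong (_* x ^ m) (inFq⇒^m≡1 c≢0 c^q≡c)) (*-identityˡ _))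

    ^q-^m-comm : ∀ x → (x ^ q) ^ m ≡ (x ^ m) ^ q
    ^q-^m-comm x = trans (sym (^-* x q m)) (trans (cong (x ^_) (ℕ.*-comm q m)) (^-* x m q))

    ^[q+1]-^m : ∀ x → (x ^ (q ℕ.+ 1)) ^ m ≡ x ^ m * (x ^ m) ^ q
    ^[q+1]-^m x = begin
      (x ^ (q ℕ.+ 1)) ^ m        ≡⟨ ^-* x (q ℕ.+ 1) m ⟨
      x ^ ((q ℕ.+ 1) ℕ.* m)      ≡⟨ cong (x ^_) ([q+1]*m≡m+m*q m) ⟩
      x ^ (m ℕ.+ m ℕ.* q)        ≡⟨ ^-+ x m (m ℕ.* q) ⟩
      x ^ m * x ^ (m ℕ.* q)      ≡⟨ cong (x ^ m *_) (^-* x m q) ⟩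
      x ^ m * (x ^ m) ^ q        ∎

    frobenius-neg : ∀ x → (- x) ^ q ≡ - (x ^ q)
    frobenius-neg x = x+y≡0⇒x≡-y (begin
      (- x) ^ q + x ^ q   ≡⟨ frobenius (- x) x ⟨
      (- x + x) ^ q       ≡⟨ cong (_^ q) (-‿inverseˡ x) ⟩
      0# ^ q              ≡⟨ zeroˡ _ ⟩
      0#                  ∎)

    frobenius-sum : ∀ {a b} → a + b + 1# ≡ 0# → a ^ q + b ^ q + 1# ≡ 0#
    frobenius-sum {a} {b} e = begin
      a ^ q + b ^ q + 1#       ≡⟨ cong (a ^ q + b ^ q +_) (1^ q) ⟨
      a ^ q + b ^ q + 1# ^ q   ≡⟨ cong (_+ 1# ^ q) (frobenius a b) ⟨
      (a + b) ^ q + 1# ^ q     ≡⟨ frobenius (a + b) 1# ⟨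
      (a + b + 1#) ^ q         ≡⟨ cong (_^ q) e ⟩
      0# ^ q                   ≡⟨ zeroˡ _ ⟩
      0#                       ∎

    norm : Carrier → Carrier
    norm z = z * (z ^ q * (z ^ q) ^ q)

    norm-^m≡1 : ∀ {U} → U ≢ 0# → norm (U ^ m) ≡ 1#
    norm-^m≡1 {U} U≢0 = *-cancelˡ U≢0 (begin
      U * (U ^ m * ((U ^ m) ^ q * ((U ^ m) ^ q) ^ q))   ≡⟨ cong (λ t → U * (U ^ m * (t * t ^ q))) (^-* U m q) ⟨
      U * (U ^ m * (U ^ (m ℕ.* q) * (U ^ (m ℕ.* q)) ^ q)) ≡⟨ cong (λ t → U * (U ^ m * (U ^ (m ℕ.* q) * t))) (^-* U (m ℕ.* q) q) ⟨
      U * (U ^ m * (U ^ (m ℕ.* q) * U ^ (m ℕ.* q ℕ.* q))) ≡⟨ cong (λ t → U * (U ^ m * t)) (^-+ U (m ℕ.* q) (m ℕ.* q ℕ.* q)) ⟨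
      U * (U ^ m * U ^ (m ℕ.* q ℕ.+ m ℕ.* q ℕ.* q))     ≡⟨ cong (U *_) (^-+ U m (m ℕ.* q ℕ.+ m ℕ.* q ℕ.* q)) ⟨
      U ^ suc (m ℕ.+ (m ℕ.* q ℕ.+ m ℕ.* q ℕ.* q))       ≡⟨ cong (U ^_) (q^3≡1+m+m*q+m*q*q m) ⟩
      U ^ (q ℕ.^ 3)                                      ≡⟨ fermat U ⟩
      U                                                  ≡⟨ *-identityʳ U ⟨
      U * 1#                                             ∎)

    P : Carrier → Carrier
    P x = x * x ^ q + x + 1#

    norm-dichotomy : ∀ {a b} → a + b + 1# ≡ 0# → norm a ≡ 1# → norm b ≡ 1# →
               P b ≡ 0# ⊎ b * b ^ q + b ^ q + 1# ≡ 0#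
    norm-dichotomy {a} {b} e Na≡1 Nb≡1 = x*y≡0⇒x≡0⊎y≡0 (norm-relation Nb≡1 (begin
      - (b + 1#) * (- (b ^ q + 1#) * - ((b ^ q) ^ q + 1#))  ≡⟨ cong₂ (λ x y → x * y) a≡ (cong₂ _*_ a^q≡ a^q^q≡) ⟨
      norm a                                                ≡⟨ Na≡1 ⟩
      1#                                                    ∎))
      where
      a≡ = x+y+1≡0⇒x≡-[y+1] e
      a^q≡ = x+y+1≡0⇒x≡-[y+1] (frobenius-sum e)
      a^q^q≡ = x+y+1≡0⇒x≡-[y+1] (frobenius-sum (frobenius-sum e))

    T≡x*P[x^m] : ∀ x → T q x ≡ x * P (x ^ m)
    T≡x*P[x^m] x = begin
      x ^ (q ℕ.* q) + x ^ q + x                      ≡⟨ cong (λ t → t + x ^ q + x) x^[q*q] ⟩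
      x * (x ^ m * (x ^ m) ^ q) + x * x ^ m + x      ≡⟨ solve 3 (λ x A B → x :* A :+ x :* B :+ x := x :* (A :+ B :+ con 1)) refl x _ _ ⟩
      x * (x ^ m * (x ^ m) ^ q + x ^ m + 1#)         ∎
      where
      x^[q*q] : x ^ (q ℕ.* q) ≡ x * (x ^ m * (x ^ m) ^ q)
      x^[q*q] = begin
        x ^ (q ℕ.* q)                ≡⟨ cong (x ^_) (q*q≡1+m+m*q m) ⟩
        x * x ^ (m ℕ.+ m ℕ.* q)      ≡⟨ cong (x *_) (^-+ x m (m ℕ.* q)) ⟩
        x * (x ^ m * x ^ (m ℕ.* q))  ≡⟨ cong (λ t → x * (x ^ m * t)) (^-* x m q) ⟩
        x * (x ^ m * (x ^ m) ^ q)    ∎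

    P≡0⇒T≡0 : ∀ {x} → P (x ^ m) ≡ 0# → T q x ≡ 0#
    P≡0⇒T≡0 {x} P≡0 = trans (T≡x*P[x^m] x) (trans (cong (x *_) P≡0) (zeroʳ x))

    T≡0⇒P≡0 : ∀ {x} → x ≢ 0# → T q x ≡ 0# → P (x ^ m) ≡ 0#
    T≡0⇒P≡0 {x} x≢0 T≡0 = *-cancelˡ x≢0 (trans (sym (T≡x*P[x^m] x)) (trans T≡0 (sym (zeroʳ x))))

    *-P-reciprocal : ∀ {b β} → b * β ≡ 1# → b * P β ≡ β ^ q + b + 1#
    *-P-reciprocal {b} {β} bβ≡1 = begin
      b * (β * β ^ q + β + 1#)        ≡⟨ solve 3 (λ b β β′ → b :* (β :* β′ :+ β :+ con 1) := b :* β :* β′ :+ (b :* β :+ b)) refl b β (β ^ q) ⟩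
      b * β * β ^ q + (b * β + b)     ≡⟨ cong (λ t → t * β ^ q + (t + b)) bβ≡1 ⟩
      1# * β ^ q + (1# + b)           ≡⟨ solve 2 (λ β′ b → con 1 :* β′ :+ (con 1 :+ b) := β′ :+ b :+ con 1) refl (β ^ q) b ⟩
      β ^ q + b + 1#                  ∎

    ^m-scale : ∀ l a b c → (l * a) ^ m + (l * b) ^ m + (l * c) ^ m ≡ l ^ m * (a ^ m + b ^ m + c ^ m)
    ^m-scale l a b c = begin
      (l * a) ^ m + (l * b) ^ m + (l * c) ^ m   ≡⟨ cong₂ _+_ (cong₂ _+_ (*-^ l a m) (*-^ l b m)) (*-^ l c m) ⟩
      L * a ^ m + L * b ^ m + L * c ^ m         ≡⟨ solve 4 (λ L A B C → L :* A :+ L :* B :+ L :* C := L :* (A :+ B :+ C)) refl L (a ^ m) (b ^ m) (c ^ m) ⟩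
      L * (a ^ m + b ^ m + c ^ m)               ∎
      where L = l ^ m

    OnCurve-invariant : ∀ {u v w a b c} → SamePoint u v w a b c → OnCurve q a b c → OnCurve q u v w
    OnCurve-invariant {a = a} {b} {c} (l , _ , refl , refl , refl) oc =
      trans (^m-scale l a b c) (trans (cong (l ^ m *_) oc) (zeroʳ _))

    affine-form1 : ∀ {U V} → U ≢ 0# → V ≢ 0# → U ^ m + V ^ m + 1# ≡ 0# → P (V ^ m) ≡ 0# → Form1 q U V 1#
    affine-form1 {U} {V} U≢0 V≢0 e P[b]≡0 =
      (c , V , (^m≡1⇒inFq c^m≡1 , *-≢0 U≢0 (inv-≢0 W≢0)) , V≢0 , P≡0⇒T≡0 P[b]≡0 , SamePoint-≡ U≡cW refl refl)
      where
      b = V ^ m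
      W = V ^ (q ℕ.+ 1)
      W≢0 = ^-≢0 (q ℕ.+ 1) V≢0
      c = U * inv W W≢0
      U^m≡W^m : U ^ m ≡ W ^ m
      U^m≡W^m = begin
        U ^ m         ≡⟨ x+y+1≡0⇒x≡-[y+1] e ⟩
        - (b + 1#)    ≡⟨ x+y+1≡0⇒x≡-[y+1] P[b]≡0 ⟨
        b * b ^ q     ≡⟨ ^[q+1]-^m V ⟨
        W ^ m         ∎
      c^m≡1 : c ^ m ≡ 1#
      c^m≡1 = begin
        (U * inv W W≢0) ^ m       ≡⟨ *-^ U _ m ⟩
        U ^ m * inv W W≢0 ^ m     ≡⟨ cong (_* inv W W≢0 ^ m) U^m≡W^m ⟩
        W ^ m * inv W W≢0 ^ m     ≡⟨ *-^ W _ m ⟨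
        (W * inv W W≢0) ^ m       ≡⟨ cong (_^ m) (inv-inverseʳ W≢0) ⟩
        1# ^ m                    ≡⟨ 1^ m ⟩
        1#                        ∎
      U≡cW : U ≡ c * W
      U≡cW = sym (trans (*-assoc U _ W) (trans (cong (U *_) (inv-inverseˡ W≢0)) (*-identityʳ U)))
    affine-form2 : ∀ {U V} → U ≢ 0# → V ≢ 0# → U ^ m + V ^ m + 1# ≡ 0# →
                   V ^ m * (V ^ m) ^ q + (V ^ m) ^ q + 1# ≡ 0# → Form2 q U V 1#
    affine-form2 {U} {V} U≢0 V≢0 e R≡0 =
      (c , V , s , (^m≡1⇒inFq c^m≡1 , *-≢0 U≢0 (^-≢0 q V≢0)) , V≢0 , Vs≡1 , P≡0⇒T≡0 P[β]≡0 , SamePoint-≡ U≡cs^q refl refl)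
      where
      a = U ^ m
      b = V ^ m
      b≢0 = ^-≢0 m V≢0
      s = inv V V≢0
      Vs≡1 = inv-inverseʳ V≢0
      β = s ^ m
      bβ≡1 : b * β ≡ 1#
      bβ≡1 = trans (sym (*-^ V s m)) (trans (cong (_^ m) Vs≡1) (1^ m))
      ab^q≡1 : a * b ^ q ≡ 1#
      ab^q≡1 = begin
        a * b ^ q                               ≡⟨ +-identityʳ _ ⟨
        a * b ^ q + 0#                          ≡⟨ cong (a * b ^ q +_) R≡0 ⟨
        a * b ^ q + (b * b ^ q + b ^ q + 1#)    ≡⟨ solve 3 (λ a b b′ → a :* b′ :+ (b :* b′ :+ b′ :+ con 1) := b′ :* (a :+ b :+ con 1) :+ con 1) refl a b (b ^ q) ⟩
        b ^ q * (a + b + 1#) + 1#               ≡⟨ cong (λ t → b ^ q * t + 1#) e ⟩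
        b ^ q * 0# + 1#                         ≡⟨ cong (_+ 1#) (zeroʳ _) ⟩
        0# + 1#                                 ≡⟨ +-identityˡ 1# ⟩
        1#                                      ∎
      β^q≡a : β ^ q ≡ a
      β^q≡a = *-cancelˡ (^-≢0 q b≢0) (begin
        b ^ q * β ^ q      ≡⟨ *-^ b β q ⟨
        (b * β) ^ q        ≡⟨ cong (_^ q) bβ≡1 ⟩
        1# ^ q             ≡⟨ 1^ q ⟩
        1#                 ≡⟨ ab^q≡1 ⟨
        a * b ^ q          ≡⟨ *-comm a _ ⟩
        b ^ q * a          ∎)
      P[β]≡0 : P β ≡ 0#
      P[β]≡0 = *-cancelˡ b≢0 (begin
        b * P β           ≡⟨ *-P-reciprocal bβ≡1 ⟩
        β ^ q + b + 1#    ≡⟨ cong (λ t → t + b + 1#) β^q≡a ⟩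
        a + b + 1#        ≡⟨ e ⟩
        0#                ≡⟨ zeroʳ b ⟨
        b * 0#            ∎)
      c = U * V ^ q
      c^m≡1 : c ^ m ≡ 1#
      c^m≡1 = trans (*-^ U (V ^ q) m) (trans (cong (a *_) (^q-^m-comm V)) ab^q≡1)
      U≡cs^q : U ≡ c * s ^ q
      U≡cs^q = sym (begin
        U * V ^ q * s ^ q      ≡⟨ *-assoc U _ _ ⟩
        U * (V ^ q * s ^ q)    ≡⟨ cong (U *_) (*-^ V s q) ⟨
        U * (V * s) ^ q        ≡⟨ cong (λ t → U * t ^ q) Vs≡1 ⟩
        U * 1# ^ q             ≡⟨ cong (U *_) (1^ q) ⟩
        U * 1#                 ≡⟨ *-identityʳ U ⟩
        U                      ∎)

    affine-forms : ∀ {U V} → U ≢ 0# → V ≢ 0# → U ^ m + V ^ m + 1# ≡ 0# → Form1 q U V 1# ⊎ Form2 q U V 1#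
    affine-forms U≢0 V≢0 e =
      Sum.map (affine-form1 U≢0 V≢0 e) (affine-form2 U≢0 V≢0 e) (norm-dichotomy e (norm-^m≡1 U≢0) (norm-^m≡1 V≢0))

    x^m+y^m≡0⇒char2∧ratio∈Fq* : ∀ {X Y} → Y ≢ 0# → X ^ m + Y ^ m ≡ 0# → 1# + 1# ≡ 0# × ∃ λ Z → InFqStar q Z × X ≡ Y * Z
    x^m+y^m≡0⇒char2∧ratio∈Fq* {X} {Y} Y≢0 e = 1+1≡0 , Z , (^m≡1⇒inFq (trans Z^m≡-1 -1≡1) , Z≢0) , sym (x*[x⁻¹*y]≡y Y≢0 X)
      where
      Z = inv Y Y≢0 * X
      Z^m+1≡0 : Z ^ m + 1# ≡ 0#
      Z^m+1≡0 = *-cancelˡ (^-≢0 m Y≢0) (begin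
        Y ^ m * (Z ^ m + 1#)          ≡⟨ distribˡ _ _ _ ⟩
        Y ^ m * Z ^ m + Y ^ m * 1#    ≡⟨ cong₂ _+_ (*-^ Y Z m) (sym (*-identityʳ _)) ⟨
        (Y * Z) ^ m + Y ^ m           ≡⟨ cong (λ t → t ^ m + Y ^ m) (x*[x⁻¹*y]≡y Y≢0 X) ⟩
        X ^ m + Y ^ m                 ≡⟨ e ⟩
        0#                            ≡⟨ zeroʳ _ ⟨
        Y ^ m * 0#                    ∎)
      Z^m≡-1 : Z ^ m ≡ - 1#
      Z^m≡-1 = x+y≡0⇒x≡-y Z^m+1≡0
      Z≢0 : Z ≢ 0#
      Z≢0 Z≡0 = 1≢0 (begin
        1#              ≡⟨ +-identityˡ 1# ⟨
        0# + 1#         ≡⟨ cong (_+ 1#) 0^m≡0 ⟨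
        0# ^ m + 1#     ≡⟨ cong (λ t → t ^ m + 1#) Z≡0 ⟨
        Z ^ m + 1#      ≡⟨ Z^m+1≡0 ⟩
        0#              ∎)
      -1^q≡-1 : (- 1#) ^ q ≡ - 1#
      -1^q≡-1 = trans (frobenius-neg 1#) (cong -_ (1^ q))
      -1≡1 : - 1# ≡ 1#
      -1≡1 = begin
        - 1#                        ≡⟨ *-identityʳ (- 1#) ⟨
        - 1# * 1#                   ≡⟨ cong (- 1# *_) (trans (-x*-y≡x*y 1# 1#) (*-identityˡ 1#)) ⟨
        - 1# * (- 1# * - 1#)        ≡⟨ cong₂ (λ x y → - 1# * (x * y)) -1^q≡-1 (trans (cong (_^ q) -1^q≡-1) -1^q≡-1) ⟨
        norm (- 1#)                 ≡⟨ cong norm Z^m≡-1 ⟨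
        norm (Z ^ m)                ≡⟨ norm-^m≡1 Z≢0 ⟩
        1#                          ∎
      1+1≡0 : 1# + 1# ≡ 0#
      1+1≡0 = trans (cong (1# +_) (sym -1≡1)) (-‿inverseʳ 1#)

    other-≢0 : ∀ {X Y} → X ^ m + Y ^ m ≡ 0# → ¬ (X ≡ 0# × Y ≡ 0#) → Y ≢ 0#
    other-≢0 {X} e nz refl = nz (x^k≡0⇒x≡0 k (trans (sym (trans (cong (X ^ m +_) 0^m≡0) (+-identityʳ _))) e) , refl)

    u≡0-form : ∀ {v w} → ¬ (v ≡ 0# × w ≡ 0#) → v ^ m + w ^ m ≡ 0# → 2 ∣ q × Form3 q 0# v w
    u≡0-form {v} {w} nz e with w≢0 ← other-≢0 e nz | 1+1≡0 , Z , (Z^q≡Z , Z≢0) , v≡wZ ← x^m+y^m≡0⇒char2∧ratio∈Fq* (other-≢0 e nz) e =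
      Equivalence.from char2 1+1≡0 ,
      0# , Z , 1# , zeroˡ _ , Z^q≡Z , 1^ q , inj₁ (refl , Z≢0 , 1≢0) ,
      w , w≢0 , sym (zeroʳ w) , v≡wZ , sym (*-identityʳ w)

    v≡0-form : ∀ {u w} → ¬ (u ≡ 0# × w ≡ 0#) → u ^ m + w ^ m ≡ 0# → 2 ∣ q × Form3 q u 0# w
    v≡0-form {u} {w} nz e with w≢0 ← other-≢0 e nz | 1+1≡0 , Z , (Z^q≡Z , Z≢0) , u≡wZ ← x^m+y^m≡0⇒char2∧ratio∈Fq* (other-≢0 e nz) e =
      Equivalence.from char2 1+1≡0 ,
      Z , 0# , 1# , Z^q≡Z , zeroˡ _ , 1^ q , inj₂ (inj₁ (Z≢0 , refl , 1≢0)) ,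
      w , w≢0 , u≡wZ , sym (zeroʳ w) , sym (*-identityʳ w)

    w≡0-form : ∀ {u v} → ¬ (u ≡ 0# × v ≡ 0#) → u ^ m + v ^ m ≡ 0# → 2 ∣ q × Form3 q u v 0#
    w≡0-form {u} {v} nz e with v≢0 ← other-≢0 e nz | 1+1≡0 , Z , (Z^q≡Z , Z≢0) , u≡vZ ← x^m+y^m≡0⇒char2∧ratio∈Fq* (other-≢0 e nz) e =
      Equivalence.from char2 1+1≡0 ,
      Z , 1# , 0# , Z^q≡Z , 1^ q , zeroˡ _ , inj₂ (inj₂ (Z≢0 , 1≢0 , refl)) ,
      v , v≢0 , u≡vZ , sym (*-identityʳ v) , sym (zeroʳ v)

    forward : ∀ {u v w} → NonZeroTriple u v w → OnCurve q u v w → Forms q u v w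
    forward {u} {v} {w} nz oc with u ≟ 0# | v ≟ 0# | w ≟ 0#
    ... | yes refl | _ | _ = inj₂ (inj₂ (u≡0-form (λ (v≡0 , w≡0) → nz (refl , v≡0 , w≡0))
          (trans (cong (_+ w ^ m) (sym (trans (cong (_+ v ^ m) 0^m≡0) (+-identityˡ _)))) oc)))
    ... | no _ | yes refl | _ = inj₂ (inj₂ (v≡0-form (λ (u≡0 , w≡0) → nz (u≡0 , refl , w≡0))
          (trans (cong (_+ w ^ m) (sym (trans (cong (u ^ m +_) 0^m≡0) (+-identityʳ _)))) oc)))
    ... | no _ | no _ | yes refl = inj₂ (inj₂ (w≡0-form (λ (u≡0 , v≡0) → nz (u≡0 , v≡0 , refl))
          (trans (sym (trans (cong (u ^ m + v ^ m +_) 0^m≡0) (+-identityʳ _))) oc)))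
    ... | no u≢0 | no v≢0 | no w≢0 =
      Sum.map (Form1-invariant {q} sp) (inj₁ ∘ Form2-invariant {q} sp)
        (affine-forms (*-≢0 (inv-≢0 w≢0) u≢0) (*-≢0 (inv-≢0 w≢0) v≢0) affine)
      where
      U = inv w w≢0 * u
      V = inv w w≢0 * v
      sp : SamePoint u v w U V 1#
      sp = w , w≢0 , sym (x*[x⁻¹*y]≡y w≢0 u) , sym (x*[x⁻¹*y]≡y w≢0 v) , sym (*-identityʳ w)
      affine : U ^ m + V ^ m + 1# ≡ 0#
      affine = trans (cong (U ^ m + V ^ m +_) (sym (1^ m))) (OnCurve-invariant (SamePoint-sym sp) oc)

    Form3-on-curve : 1# + 1# ≡ 0# → ∀ {a b c} → InFq q a → InFq q b → InFq q c → ExactlyOneZero a b c →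
                     a ^ m + b ^ m + c ^ m ≡ 0#
    Form3-on-curve 1+1≡0 _ b∈Fq c∈Fq (inj₁ (refl , b≢0 , c≢0)) =
      trans (cong₂ _+_ (cong₂ _+_ 0^m≡0 (inFq⇒^m≡1 b≢0 b∈Fq)) (inFq⇒^m≡1 c≢0 c∈Fq))
            (trans (cong (_+ 1#) (+-identityˡ 1#)) 1+1≡0)
    Form3-on-curve 1+1≡0 a∈Fq _ c∈Fq (inj₂ (inj₁ (a≢0 , refl , c≢0))) =
      trans (cong₂ _+_ (cong₂ _+_ (inFq⇒^m≡1 a≢0 a∈Fq) 0^m≡0) (inFq⇒^m≡1 c≢0 c∈Fq))
            (trans (cong (_+ 1#) (+-identityʳ 1#)) 1+1≡0)
    Form3-on-curve 1+1≡0 a∈Fq b∈Fq _ (inj₂ (inj₂ (a≢0 , b≢0 , refl))) =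
      trans (cong₂ _+_ (cong₂ _+_ (inFq⇒^m≡1 a≢0 a∈Fq) (inFq⇒^m≡1 b≢0 b∈Fq)) 0^m≡0)
            (trans (+-identityʳ _) 1+1≡0)

    backward : ∀ {u v w} → Forms q u v w → OnCurve q u v w
    backward (inj₁ (c , t , c∈Fq* , t≢0 , Tt≡0 , sp)) = OnCurve-invariant sp (begin
      (c * t ^ (q ℕ.+ 1)) ^ m + t ^ m + 1# ^ m   ≡⟨ cong₂ (λ x y → x + t ^ m + y) (trans (InFqStar-*-^m c∈Fq* _) (^[q+1]-^m t)) (1^ m) ⟩
      t ^ m * (t ^ m) ^ q + t ^ m + 1#           ≡⟨ T≡0⇒P≡0 t≢0 Tt≡0 ⟩
      0#                                         ∎)
    backward (inj₂ (inj₁ (c , t , s , c∈Fq* , t≢0 , ts≡1 , Ts≡0 , sp))) = OnCurve-invariant sp (begin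
      (c * s ^ q) ^ m + t ^ m + 1# ^ m   ≡⟨ cong₂ (λ x y → x + t ^ m + y) (trans (InFqStar-*-^m c∈Fq* _) (^q-^m-comm s)) (1^ m) ⟩
      (s ^ m) ^ q + t ^ m + 1#           ≡⟨ *-P-reciprocal t^m*s^m≡1 ⟨
      t ^ m * P (s ^ m)                  ≡⟨ cong (t ^ m *_) (T≡0⇒P≡0 s≢0 Ts≡0) ⟩
      t ^ m * 0#                         ≡⟨ zeroʳ _ ⟩
      0#                                 ∎)
      where
      s≢0 : s ≢ 0#
      s≢0 refl = 1≢0 (trans (sym ts≡1) (zeroʳ t))
      t^m*s^m≡1 : t ^ m * s ^ m ≡ 1#
      t^m*s^m≡1 = trans (sym (*-^ t s m)) (trans (cong (_^ m) ts≡1) (1^ m))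
    backward (inj₂ (inj₂ (2∣q , a , b , c , a∈Fq , b∈Fq , c∈Fq , one-zero , sp))) =
      OnCurve-invariant sp (Form3-on-curve (Equivalence.to char2 2∣q) a∈Fq b∈Fq c∈Fq one-zero)

    classification : ∀ {u v w} → NonZeroTriple u v w → OnCurve q u v w ⇔ Forms q u v w
    classification nz = mk⇔ (forward nz) backward

  classify : ∀ q → 2 ≤ q → (∀ x y → (x + y) ^ q ≡ x ^ q + y ^ q) → (∀ x → x ^ (q ℕ.^ 3) ≡ x) →
             (2 ∣ q ⇔ 1# + 1# ≡ 0#) → Classification q
  classify (suc zero) (s≤s ())
  classify (suc (suc k)) _ frobenius fermat char2 _ _ _ = classification k frobenius fermat char2

open import Data.Nat using (_^_; _≥_)

theorem2 : (p r : ℕ) → Prime p → r ≥ 1 →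
  (K : FiniteField ((p ^ r) ^ 3)) →
  let q = p ^ r
      open FiniteField K
  in (u v w : Carrier) → NonZeroTriple u v w →
     (OnCurve q u v w ⇔
       (Form1 q u v w ⊎ Form2 q u v w ⊎ (2 ∣ q × Form3 q u v w)))
theorem2 p (suc r) pp _ K =
  Curve.classify K (p ℕ.^ suc r) (2≤p^[1+r] pp r) (frobenius pp p·1≡0 (suc r)) fermat char2
  where
  open FiniteField K
  open FiniteFieldProperties K
  p·1≡0 : p · 1# ≡ 0#
  p·1≡0 = ^·1≡0⇒·1≡0 p r (^·1≡0⇒·1≡0 (p ℕ.^ suc r) 2 characteristic)
  char2 : 2 ∣ p ℕ.^ suc r ⇔ 1# + 1# ≡ 0#
  char2 = mk⇔ (Equivalence.to 2∣p⇔ ∘ prime∣^⇒∣ p (suc r) prime[2]) (∣m⇒∣m*n (p ℕ.^ r) ∘ Equivalence.from 2∣p⇔)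
    where 2∣p⇔ = prime-char-2∣⇔1+1≡0 pp p·1≡0
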